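{- For every $n\ge 1$, the set of restricted involutions on $2n$ letters is in bijection with the set of skew-symmetric $(n,n)$-clans.
   Context: An $(n,n)$-clan is a string $\gamma=c_1\cdots c_{2n}$ of symbols from $\mathbb{N}\cup\{+,-\}$ such that each natural number appearing in $\gamma$ appears exactly twice, and the number of $+$'s equals the number of $-$'s; two clans are equal if they have the same $\pm$ symbols in the same positions and the same sets of positions of matching pairs of natural numbers. With $rev(\gamma)=c_{2n}\cdots c_1$ and $-\gamma$ obtained by interchanging $+$ and $-$, $\gamma$ is skew-symmetric if $\gamma=-rev(\gamma)$. A signed permutation of $m$ letters (an element of the hyperoctahedral group $\mathcal{C}_m$) is a word $\hat\pi=\hat\pi(1)\cdots\hat\pi(m)$ in which each of $1,\dots,m$ appears exactly once, possibly barred (a bar indicates a negative sign); $|\hat\pi|$ denotes the permutation obtained by removing all bars. A signed involution on $m$ letters is a signed permutation whose cycle representation consists of cycles (fixed points or $2$-cycles) whose symbols are either all unbarred or all barred; equivalently $|\hat\pi|$ is an involution and, for a $2$-cycle $(i,j)$ of $|\hat\pi|$, $\hat\pi(i)$ is barred iff $\hat\pi(j)$ is barred. The reverse is $\mathrm{Rev}(\hat\pi)=\hat\pi(m)\cdots\hat\pi(1)$; the complement $\mathrm{Comp}(\hat\pi)$ replaces each entry $a$ (barred or not) by $m+1-a$ with the same bar status. A signed permutation $\hat\pi$ avoids the pattern $\bar2\bar1$ if there are no indices $i<j$ with $\hat\pi(i)$ and $\hat\pi(j)$ both barred and $|\hat\pi(i)|>|\hat\pi(j)|$. A restricted involution on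 $2n$ letters is a signed involution $\hat\pi$ on $2n$ letters with $\hat\pi=\mathrm{Rev}(\mathrm{Comp}(\hat\pi))$ that avoids the pattern $\bar2\bar1$. -}

module Defs where

open import Data.Nat using (ℕ; _≤_; _*_)
open import Data.Nat.Properties using () renaming (_≟_ to _≟ℕ_)
open import Data.Bool using (Bool; true; false)
open import Data.Fin using (Fin; opposite) renaming (_<_ to _<F_)
open import Data.Fin.Properties using () renaming (_≟_ to _≟F_)
open import Data.Vec using (Vec; lookup; reverse; map; count)
open import Data.Vec.Membership.Propositional using (_∈_)
open import Data.Product using (Σ; _×_; _,_; proj₁; proj₂; ∃)
open import Function.Bundles using (_⇔_)
open import Relation.Nullary using (¬_; Dec; yes; no)
open import Relation.Binary.PropositionalEquality using (_≡_; _≢_; refl)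

data Sym : Set where
  num   : ℕ → Sym
  plus  : Sym
  minus : Sym

_≟S_ : (x y : Sym) → Dec (x ≡ y)
num a ≟S num b with a ≟ℕ b
... | yes refl = yes refl
... | no a≢b = no λ { refl → a≢b refl }
num _ ≟S plus  = no λ ()
num _ ≟S minus = no λ ()
plus ≟S num _  = no λ ()
plus ≟S plus   = yes refl
plus ≟S minus  = no λ ()
minus ≟S num _ = no λ ()
minus ≟S plus  = no λ ()
minus ≟S minus = yes refl

IsClan : ∀ {m} → Vec Sym m → Set
IsClan γ =
  (∀ k → num k ∈ γ → count (_≟S num k) γ ≡ 2)
  × count (_≟S plus) γ ≡ count (_≟S minus) γ

Matched : ∀ {m} → Vec Sym m → Fin m → Fin m → Set
Matched γ i j = ∃ λ k → lookup γ i ≡ num k × lookup γ j ≡ num k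

_≈Clan_ : ∀ {m} → Vec Sym m → Vec Sym m → Set
γ ≈Clan δ =
  (∀ i → (lookup γ i ≡ plus ⇔ lookup δ i ≡ plus))
  × (∀ i → (lookup γ i ≡ minus ⇔ lookup δ i ≡ minus))
  × (∀ i j → i ≢ j → (Matched γ i j ⇔ Matched δ i j))

negS : Sym → Sym
negS (num k) = num k
negS plus    = minus
negS minus   = plus

negClan : ∀ {m} → Vec Sym m → Vec Sym m
negClan = map negS

IsSkewSymmetric : ∀ {m} → Vec Sym m → Set
IsSkewSymmetric γ = γ ≈Clan negClan (reverse γ)

-- Skew-symmetric (n,n)-clans (carrier; equality is _≈Clan_ on the string).
SkewClan : ℕ → Set
SkewClan n = Σ (Vec Sym (2 * n)) λ γ → IsClan γ × IsSkewSymmetric γ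

-- A signed letter: (barred?, value).  Letters 1..m are represented by Fin m
-- (0-based: the letter a is represented by a - 1).
SLetter : ℕ → Set
SLetter m = Bool × Fin m

barred : ∀ {m} → SLetter m → Bool
barred = proj₁

∣_∣ : ∀ {m} → SLetter m → Fin m
∣_∣ = proj₂

IsSignedPerm : ∀ {m} → Vec (SLetter m) m → Set
IsSignedPerm {m} π = ∀ (a : Fin m) → count (λ x → ∣ x ∣ ≟F a) π ≡ 1

IsSignedInvolution : ∀ {m} → Vec (SLetter m) m → Set
IsSignedInvolution π =
  IsSignedPerm π
  × (∀ i → ∣ lookup π ∣ lookup π i ∣ ∣ ≡ i)
  × (∀ i → barred (lookup π i) ≡ barred (lookup π ∣ lookup π i ∣))

Comp : ∀ {m} → Vec (SLetter m) m → Vec (SLetter m) m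
Comp = map λ x → (barred x , opposite ∣ x ∣)

Rev : ∀ {m} → Vec (SLetter m) m → Vec (SLetter m) m
Rev = reverse

Avoids2̄1̄ : ∀ {m} → Vec (SLetter m) m → Set
Avoids2̄1̄ π = ∀ i j → i <F j →
  barred (lookup π i) ≡ true → barred (lookup π j) ≡ true →
  ¬ (∣ lookup π j ∣ <F ∣ lookup π i ∣)

IsRestrictedInvolution : ∀ {m} → Vec (SLetter m) m → Set
IsRestrictedInvolution π =
  IsSignedInvolution π × π ≡ Rev (Comp π) × Avoids2̄1̄ π

-- Restricted involutions on 2n letters (equality: equality of words).
RestrictedInvolution : ℕ → Set
RestrictedInvolution n =
  Σ (Vec (SLetter (2 * n)) (2 * n)) IsRestrictedInvolution

-- Bijection between restricted involutions (words up to ≡) and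
-- skew-symmetric clans (strings up to clan equality _≈Clan_):
-- a well-defined, injective, surjective map.
Bijective : ∀ n → (RestrictedInvolution n → SkewClan n) → Set
Bijective n f =
  (∀ a b → proj₁ a ≡ proj₁ b → proj₁ (f a) ≈Clan proj₁ (f b))
  × (∀ a b → proj₁ (f a) ≈Clan proj₁ (f b) → proj₁ a ≡ proj₁ b)
  × (∀ (c : SkewClan n) → ∃ λ a → proj₁ (f a) ≈Clan proj₁ c)

module Submission where

-- A restricted involution π is determined by p = ∣π∣ and its bar pattern b. Restrictedness
-- says exactly that p is an involution commuting with i ↦ opposite i, that b is invariant
-- under it, and that only fixed points of p are barred (a barred 2-cycle is a 2̄1̄). Encode π
-- by the clan whose i-th symbol is the label min(i, p i) if p i ≠ i, and otherwise the sign
-- "i lies in the first half" xor "π(i) is barred" (true = +, false = −), which flips under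
-- i ↦ opposite i. The symmetry of π thus becomes skew-symmetry of the clan, and the two
-- labels of a pair mark a 2-cycle. Conversely, every position of a skew-symmetric clan
-- decodes to exactly one letter (b i , p i), and these letters form a restricted involution
-- whose clan is the given one.

open import Defs

open import Data.Bool using (Bool; true; false; if_then_else_; not; _xor_)
open import Data.Bool.Properties
  using (not-involutive; not-injective; not-distribˡ-xor; xor-same; xor-inverseʳ)
open import Data.Fin using (Fin; zero; suc; toℕ; opposite; fromℕ; inject₁) renaming (_<_ to _<F_)
open import Data.Fin.Properties
  using (_≟_; _<?_; <-cmp; <-asym; toℕ-injective; toℕ<n; opposite-prop; opposite-involutive)
open import Data.Fin.Permutation as Permutation
  using (Permutation′; _⟨$⟩ʳ_; _⟨$⟩ˡ_; inverseʳ; inverseˡ)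
open import Data.Nat using (ℕ; zero; suc; _+_; _*_; _∸_; _⊓_; _≤_)
import Data.Nat.Properties as ℕ
open import Data.Product using (∃; ∃₂; _×_; _,_; proj₁; proj₂)
open import Data.Sum using (_⊎_; inj₁; inj₂)
open import Data.Vec using (Vec; []; _∷_; _∷ʳ_; lookup; count; reverse; tabulate)
open import Data.Vec.Properties using (reverse-∷; lookup-map; lookup∘tabulate; tabulate-cong)
open import Data.Vec.Membership.Propositional using (_∈_)
open import Data.Vec.Membership.Propositional.Properties using (∈-lookup)
open import Data.Vec.Relation.Binary.Pointwise.Extensional using (ext; Pointwise-≡⇒≡)
import Data.Vec.Relation.Unary.Any as Any
open import Data.Vec.Relation.Unary.Any.Properties using (lookup-index)
open import Function using (_∘_; id)
open import Function.Bundles using (_⇔_; mk⇔; Equivalence)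
open import Function.Construct.Composition using (_⇔-∘_)
open import Function.Construct.Symmetry using (⇔-sym)
open import Relation.Binary.Definitions using (tri<; tri≈; tri>)
open import Relation.Binary.PropositionalEquality
open import Relation.Nullary using (Dec; yes; no; does)
open import Relation.Nullary.Decidable using (dec-true; dec-false; does-⇔)
open import Relation.Nullary.Negation using (contradiction)
open import Relation.Unary using (Pred; Decidable)

open Equivalence using (to; from)

private variable
  m : ℕ

xor-cancelˡ : ∀ s {b c} → s xor b ≡ s xor c → b ≡ c
xor-cancelˡ true  = not-injective
xor-cancelˡ false = id

true⇒witness : ∀ {a} {A : Set a} (a? : Dec A) → does a? ≡ true → A
true⇒witness (yes a) _  = a
true⇒witness (no _)  ()

-- Counting the positions at which a Boolean test holds

countᶠ : (Fin m → Bool) → ℕ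
countᶠ {zero}  g = 0
countᶠ {suc m} g = (if g zero then suc else id) (countᶠ (g ∘ suc))

count≡countᶠ : ∀ {a p} {A : Set a} {P : Pred A p} (P? : Decidable P) (v : Vec A m) →
               count P? v ≡ countᶠ (λ i → does (P? (lookup v i)))
count≡countᶠ P? []      = refl
count≡countᶠ P? (x ∷ v) = cong (if does (P? x) then suc else id) (count≡countᶠ P? v)

countᶠ-cong : {g h : Fin m → Bool} → (∀ i → g i ≡ h i) → countᶠ g ≡ countᶠ h
countᶠ-cong {zero}  g≗h = refl
countᶠ-cong {suc m} g≗h =
  cong₂ (λ b n → (if b then suc else id) n) (g≗h zero) (countᶠ-cong (g≗h ∘ suc))

erase : Fin m → (Fin m → Bool) → Fin m → Bool
erase a g i = if does (i ≟ a) then false else g i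

erase-other : ∀ {a i : Fin m} g → i ≢ a → erase a g i ≡ g i
erase-other {a = a} {i} g i≢a rewrite dec-false (i ≟ a) i≢a = refl

countᶠ-erase : ∀ (g : Fin m → Bool) a → g a ≡ true → countᶠ g ≡ suc (countᶠ (erase a g))
countᶠ-erase {suc m} g zero    ga rewrite ga = refl
countᶠ-erase {suc m} g (suc a) ga with g zero
... | true  = cong suc (countᶠ-erase (g ∘ suc) a ga)
... | false = countᶠ-erase (g ∘ suc) a ga

countᶠ-all-false : (g : Fin m → Bool) → (∀ i → g i ≡ false) → countᶠ g ≡ 0
countᶠ-all-false {zero}  g g≡false = refl
countᶠ-all-false {suc m} g g≡false rewrite g≡false zero =
  countᶠ-all-false (g ∘ suc) (g≡false ∘ suc)

countᶠ≡0⇒false : (g : Fin m → Bool) → countᶠ g ≡ 0 → ∀ i → g i ≡ false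
countᶠ≡0⇒false g #g≡0 i with g i in gi
... | false = refl
... | true  = contradiction (trans (sym (countᶠ-erase g i gi)) #g≡0) λ ()

countᶠ≡suc⇒true : ∀ (g : Fin m → Bool) {k} → countᶠ g ≡ suc k → ∃ λ i → g i ≡ true
countᶠ≡suc⇒true {suc m} g #g≡1+k with g zero in g0
... | true  = zero , g0
... | false with countᶠ≡suc⇒true (g ∘ suc) #g≡1+k
...   | i , gi = suc i , gi

countᶠ-singleton : ∀ (g : Fin m → Bool) a → g a ≡ true → (∀ i → g i ≡ true → i ≡ a) →
                   countᶠ g ≡ 1
countᶠ-singleton g a ga only-a =
  trans (countᶠ-erase g a ga) (cong suc (countᶠ-all-false (erase a g) erased))
  where
  erased : ∀ i → erase a g i ≡ false
  erased i with i ≟ a | g i in gi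
  ... | yes _  | _     = refl
  ... | no  _  | false = refl
  ... | no i≢a | true  = contradiction (only-a i gi) i≢a

countᶠ-pair : ∀ (g : Fin m → Bool) {a b} → a ≢ b → g a ≡ true → g b ≡ true →
              (∀ i → g i ≡ true → i ≡ a ⊎ i ≡ b) → countᶠ g ≡ 2
countᶠ-pair g {a} {b} a≢b ga gb only-ab =
  trans (countᶠ-erase g a ga)
        (cong suc (countᶠ-singleton (erase a g) b (trans (erase-other g (a≢b ∘ sym)) gb) only-b))
  where
  only-b : ∀ i → erase a g i ≡ true → i ≡ b
  only-b i ei with i ≟ a
  ... | no i≢a with only-ab i ei
  ...   | inj₁ i≡a = contradiction i≡a i≢a
  ...   | inj₂ i≡b = i≡b

module _ (g : Fin m → Bool) (#g≡2 : countᶠ g ≡ 2) {a} (ga : g a ≡ true) where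

  private
    #erase≡1 : countᶠ (erase a g) ≡ 1
    #erase≡1 = ℕ.suc-injective (trans (sym (countᶠ-erase g a ga)) #g≡2)

  countᶠ≡2⇒other : ∃ λ b → b ≢ a × g b ≡ true
  countᶠ≡2⇒other with countᶠ≡suc⇒true (erase a g) #erase≡1
  ... | b , eb with b ≟ a
  ...   | yes _  = contradiction eb λ ()
  ...   | no b≢a = b , b≢a , eb

  countᶠ≡2⇒at-most-two : ∀ {b c} → b ≢ a → g b ≡ true → g c ≡ true → c ≡ a ⊎ c ≡ b
  countᶠ≡2⇒at-most-two {b} {c} b≢a gb gc with c ≟ a | c ≟ b
  ... | yes c≡a | _       = inj₁ c≡a
  ... | no _    | yes c≡b = inj₂ c≡b
  ... | no c≢a  | no c≢b  =
    contradiction (trans (sym rest-c) (countᶠ≡0⇒false (erase b (erase a g)) #rest≡0 c)) λ ()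
    where
    #rest≡0 : countᶠ (erase b (erase a g)) ≡ 0
    #rest≡0 = ℕ.suc-injective
      (trans (sym (countᶠ-erase (erase a g) b (trans (erase-other g b≢a) gb))) #erase≡1)
    rest-c : erase b (erase a g) c ≡ true
    rest-c = trans (erase-other (erase a g) c≢b) (trans (erase-other g c≢a) gc)

countᶠ-permute : ∀ (σ : Permutation′ m) (g : Fin m → Bool) → countᶠ (g ∘ (σ ⟨$⟩ʳ_)) ≡ countᶠ g
countᶠ-permute σ g = go _ g refl
  where
  erase-permute : ∀ a g i → erase (σ ⟨$⟩ˡ a) (g ∘ (σ ⟨$⟩ʳ_)) i ≡ erase a g (σ ⟨$⟩ʳ i)
  erase-permute a g i with i ≟ σ ⟨$⟩ˡ a | σ ⟨$⟩ʳ i ≟ a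
  ... | yes _     | yes _    = refl
  ... | no  _     | no  _    = refl
  ... | yes refl  | no σi≢a  = contradiction (inverseʳ σ) σi≢a
  ... | no  i≢σ⁻a | yes σi≡a = contradiction (trans (sym (inverseˡ σ)) (cong (σ ⟨$⟩ˡ_) σi≡a)) i≢σ⁻a

  go : ∀ k g → countᶠ g ≡ k → countᶠ (g ∘ (σ ⟨$⟩ʳ_)) ≡ k
  go zero    g #g≡0 = countᶠ-all-false _ (countᶠ≡0⇒false g #g≡0 ∘ (σ ⟨$⟩ʳ_))
  go (suc k) g #g≡1+k with countᶠ≡suc⇒true g #g≡1+k
  ... | a , ga = begin
    countᶠ (g ∘ (σ ⟨$⟩ʳ_))
      ≡⟨ countᶠ-erase _ (σ ⟨$⟩ˡ a) (trans (cong g (inverseʳ σ)) ga) ⟩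
    suc (countᶠ (erase (σ ⟨$⟩ˡ a) (g ∘ (σ ⟨$⟩ʳ_))))
      ≡⟨ cong suc (countᶠ-cong (erase-permute a g)) ⟩
    suc (countᶠ (erase a g ∘ (σ ⟨$⟩ʳ_)))
      ≡⟨ cong suc (go k (erase a g) (ℕ.suc-injective (trans (sym (countᶠ-erase g a ga)) #g≡1+k))) ⟩
    suc k
      ∎
    where open ≡-Reasoning

lookup-reverse : ∀ {A : Set} (v : Vec A m) i → lookup (reverse v) i ≡ lookup v (opposite i)
lookup-reverse v i = begin
  lookup (reverse v) i                       ≡⟨ cong (lookup (reverse v)) (opposite-involutive i) ⟨
  lookup (reverse v) (opposite (opposite i)) ≡⟨ lookup-reverse-opposite v (opposite i) ⟩
  lookup v (opposite i)                      ∎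
  where
  open ≡-Reasoning
  lookup-∷ʳ-last : ∀ {m} (v : Vec _ m) x → lookup (v ∷ʳ x) (fromℕ m) ≡ x
  lookup-∷ʳ-last []      x = refl
  lookup-∷ʳ-last (_ ∷ v) x = lookup-∷ʳ-last v x
  lookup-∷ʳ-inject₁ : ∀ {m} (v : Vec _ m) x i → lookup (v ∷ʳ x) (inject₁ i) ≡ lookup v i
  lookup-∷ʳ-inject₁ (_ ∷ v) x zero    = refl
  lookup-∷ʳ-inject₁ (_ ∷ v) x (suc i) = lookup-∷ʳ-inject₁ v x i
  lookup-reverse-opposite : ∀ {m} (v : Vec _ m) i → lookup (reverse v) (opposite i) ≡ lookup v i
  lookup-reverse-opposite (x ∷ v) zero    rewrite reverse-∷ x v = lookup-∷ʳ-last (reverse v) x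
  lookup-reverse-opposite (x ∷ v) (suc i) rewrite reverse-∷ x v =
    trans (lookup-∷ʳ-inject₁ (reverse v) x (opposite i)) (lookup-reverse-opposite v i)

opposite-injective : {i j : Fin m} → opposite i ≡ opposite j → i ≡ j
opposite-injective {i = i} {j} e =
  trans (sym (opposite-involutive i)) (trans (cong opposite e) (opposite-involutive j))

NoMiddle : ℕ → Set
NoMiddle m = ∀ (i : Fin m) → i ≢ opposite i

no-middle : ∀ n → NoMiddle (2 * n)
no-middle n i i≡i′ = ℕ.even≢odd n t (begin
  2 * n                   ≡⟨ ℕ.m∸n+n≡m (toℕ<n i) ⟨
  (2 * n ∸ suc t) + suc t ≡⟨ cong (_+ suc t) (trans (cong toℕ i≡i′) (opposite-prop i)) ⟨
  t + suc t               ≡⟨ ℕ.+-suc t t ⟩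
  suc (t + t)             ≡⟨ cong (λ u → suc (t + u)) (ℕ.+-identityʳ t) ⟨
  suc (2 * t)             ∎)
  where
  open ≡-Reasoning
  t = toℕ i

firstHalf : Fin m → Bool
firstHalf i = does (i <? opposite i)

firstHalf-opposite : NoMiddle m → ∀ i → firstHalf (opposite i) ≡ not (firstHalf i)
firstHalf-opposite no-mid i rewrite opposite-involutive i with <-cmp i (opposite i)
... | tri< i<i′ _ _ rewrite dec-true (i <? opposite i) i<i′ =
  dec-false (opposite i <? i) (<-asym i<i′)
... | tri≈ _ i≡i′ _ = contradiction i≡i′ (no-mid i)
... | tri> _ _ i′<i rewrite dec-false (i <? opposite i) (<-asym i′<i) =
  dec-true (opposite i <? i) i′<i

sign : Bool → Sym
sign true  = plus
sign false = minus

sign-injective : ∀ {s t} → sign s ≡ sign t → s ≡ t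
sign-injective {true}  {true}  _ = refl
sign-injective {false} {false} _ = refl

sign≢num : ∀ {s k} → sign s ≢ num k
sign≢num {true}  ()
sign≢num {false} ()

negS-sign : ∀ s → negS (sign s) ≡ sign (not s)
negS-sign true  = refl
negS-sign false = refl

negS≡sign⇒ : ∀ {x} s → negS x ≡ sign s → x ≡ sign (not s)
negS≡sign⇒ {plus}  false refl = refl
negS≡sign⇒ {minus} true  refl = refl
negS≡sign⇒ {num _} true  ()
negS≡sign⇒ {num _} false ()

lookup-negClan-reverse : (γ : Vec Sym m) → ∀ i →
                         lookup (negClan (reverse γ)) i ≡ negS (lookup γ (opposite i))
lookup-negClan-reverse γ i = trans (lookup-map i negS (reverse γ)) (cong negS (lookup-reverse γ i))

Matched-negClan-reverse : (γ : Vec Sym m) → ∀ i j →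
                          Matched (negClan (reverse γ)) i j ⇔ Matched γ (opposite i) (opposite j)
Matched-negClan-reverse γ i j = mk⇔
  (λ (k , δi , δj) → k , negS≡num⇒ (trans (sym (lookup-negClan-reverse γ i)) δi)
                       , negS≡num⇒ (trans (sym (lookup-negClan-reverse γ j)) δj))
  (λ (k , γi , γj) → k , trans (lookup-negClan-reverse γ i) (cong negS γi)
                       , trans (lookup-negClan-reverse γ j) (cong negS γj))
  where
  negS≡num⇒ : ∀ {x k} → negS x ≡ num k → x ≡ num k
  negS≡num⇒ {num _} refl = refl

≈Clan-refl : (γ : Vec Sym m) → γ ≈Clan γ
≈Clan-refl γ = (λ _ → mk⇔ id id) , (λ _ → mk⇔ id id) , (λ _ _ _ → mk⇔ id id)

≈Clan-sign : {γ δ : Vec Sym m} → γ ≈Clan δ → ∀ {i} s → lookup γ i ≡ sign s → lookup δ i ≡ sign s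
≈Clan-sign (same-plus , _ , _)  true  = to (same-plus _)
≈Clan-sign (_ , same-minus , _) false = to (same-minus _)

skew-intro : (γ : Vec Sym m) →
             (∀ {i} s → lookup γ i ≡ sign s → lookup γ (opposite i) ≡ sign (not s)) →
             (∀ {i j} → i ≢ j → Matched γ i j → Matched γ (opposite i) (opposite j)) →
             IsSkewSymmetric γ
skew-intro γ flips-sign keeps-pairs = same-sign true , same-sign false , same-pairs
  where
  open ≡-Reasoning
  same-sign : ∀ s i → lookup γ i ≡ sign s ⇔ lookup (negClan (reverse γ)) i ≡ sign s
  same-sign s i = mk⇔
    (λ γi → begin
      lookup (negClan (reverse γ)) i ≡⟨ lookup-negClan-reverse γ i ⟩
      negS (lookup γ (opposite i))   ≡⟨ cong negS (flips-sign s γi) ⟩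
      negS (sign (not s))            ≡⟨ negS-sign (not s) ⟩
      sign (not (not s))             ≡⟨ cong sign (not-involutive s) ⟩
      sign s                         ∎)
    (λ δi → begin
      lookup γ i
        ≡⟨ cong (lookup γ) (opposite-involutive i) ⟨
      lookup γ (opposite (opposite i))
        ≡⟨ flips-sign (not s) (negS≡sign⇒ s (trans (sym (lookup-negClan-reverse γ i)) δi)) ⟩
      sign (not (not s))
        ≡⟨ cong sign (not-involutive s) ⟩
      sign s
        ∎)
  same-pairs : ∀ i j → i ≢ j → Matched γ i j ⇔ Matched (negClan (reverse γ)) i j
  same-pairs i j i≢j = mk⇔
    (from (Matched-negClan-reverse γ i j) ∘ keeps-pairs i≢j)
    (λ δij → subst₂ (Matched γ) (opposite-involutive i) (opposite-involutive j)
      (keeps-pairs (i≢j ∘ opposite-injective) (to (Matched-negClan-reverse γ i j) δij)))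

module _ {γ : Vec Sym m} (skew : IsSkewSymmetric γ) where

  skew-sign : ∀ {i} s → lookup γ i ≡ sign s → lookup γ (opposite i) ≡ sign (not s)
  skew-sign {i} s γi = negS≡sign⇒ s
    (trans (sym (lookup-negClan-reverse γ i)) (≈Clan-sign {γ = γ} {negClan (reverse γ)} skew s γi))

  skew-matched : ∀ {i j} → i ≢ j → Matched γ i j → Matched γ (opposite i) (opposite j)
  skew-matched {i} {j} i≢j = to (Matched-negClan-reverse γ i j) ∘ to (proj₂ (proj₂ skew) i j i≢j)

  skew-balanced : count (_≟S plus) γ ≡ count (_≟S minus) γ
  skew-balanced = begin
    count (_≟S plus) γ                                   ≡⟨ count≡countᶠ (_≟S plus) γ ⟩
    countᶠ (λ i → does (lookup γ i ≟S plus))             ≡⟨ countᶠ-cong plus-flips ⟩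
    countᶠ (λ i → does (lookup γ (opposite i) ≟S minus)) ≡⟨ countᶠ-permute Permutation.reverse minus? ⟩
    countᶠ minus?                                        ≡⟨ count≡countᶠ (_≟S minus) γ ⟨
    count (_≟S minus) γ                                  ∎
    where
    open ≡-Reasoning
    minus? : Fin m → Bool
    minus? i = does (lookup γ i ≟S minus)
    plus-flips : ∀ i → does (lookup γ i ≟S plus) ≡ does (lookup γ (opposite i) ≟S minus)
    plus-flips i = does-⇔
      (mk⇔ (skew-sign true) λ γi′ →
        trans (cong (lookup γ) (sym (opposite-involutive i))) (skew-sign {opposite i} false γi′))
      (lookup γ i ≟S plus) (lookup γ (opposite i) ≟S minus)

module _ {γ : Vec Sym m} (clan : IsClan γ) where

  private
    labelled : ℕ → Fin m → Bool
    labelled k j = does (lookup γ j ≟S num k)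

    #labelled≡2 : ∀ {i k} → lookup γ i ≡ num k → countᶠ (labelled k) ≡ 2
    #labelled≡2 {i} {k} γi =
      trans (sym (count≡countᶠ (_≟S num k) γ)) (proj₁ clan k (subst (_∈ γ) γi (∈-lookup i γ)))

  clan-partner : ∀ {i k} → lookup γ i ≡ num k → ∃ λ j → j ≢ i × Matched γ i j
  clan-partner {i} {k} γi
    with countᶠ≡2⇒other (labelled k) (#labelled≡2 γi) (dec-true (lookup γ i ≟S num k) γi)
  ... | j , j≢i , γj = j , j≢i , k , γi , true⇒witness (lookup γ j ≟S num k) γj

  clan-partner-unique : ∀ {i j l} → j ≢ i → l ≢ i → Matched γ i j → Matched γ i l → j ≡ l
  clan-partner-unique {i} {j} {l} j≢i l≢i (k , γi , γj) (_ , γi′ , γl)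
    with refl ← trans (sym γi) γi′
    with countᶠ≡2⇒at-most-two (labelled k) (#labelled≡2 γi) (dec-true (lookup γ i ≟S num k) γi)
           j≢i (dec-true (lookup γ j ≟S num k) γj) (dec-true (lookup γ l ≟S num k) γl)
  ... | inj₁ l≡i = contradiction l≡i l≢i
  ... | inj₂ l≡j = sym l≡j

-- Restricted involutions as pairs (p , b)

-- π is read as p i = ∣ π(i) ∣ and b i = [π(i) is barred].
record IsRestricted (p : Fin m → Fin m) (b : Fin m → Bool) : Set where
  field
    involutive    : ∀ i → p (p i) ≡ i
    p-opposite    : ∀ i → p (opposite i) ≡ opposite (p i)
    b-opposite    : ∀ i → b (opposite i) ≡ b i
    barred⇒fixed : ∀ i → b i ≡ true → p i ≡ i

  moved⇒unbarred : ∀ {i} → p i ≢ i → b i ≡ false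
  moved⇒unbarred {i} pi≢i with b i in bi
  ... | true  = contradiction (barred⇒fixed i bi) pi≢i
  ... | false = refl

  b-cycle : ∀ i → b i ≡ b (p i)
  b-cycle i with p i ≟ i
  ... | yes pi≡i = cong b (sym pi≡i)
  ... | no  pi≢i = trans (moved⇒unbarred pi≢i)
                         (sym (moved⇒unbarred λ ppi≡pi → pi≢i (trans (sym ppi≡pi) (involutive i))))

restricted-lookup : {π : Vec (SLetter m) m} → IsRestrictedInvolution π →
                    IsRestricted (∣_∣ ∘ lookup π) (barred ∘ lookup π)
restricted-lookup {π = π} ((_ , involutive , b-cycle) , π≡RevComp , avoids) = record
  { involutive    = involutive
  ; p-opposite    = λ i → trans (cong proj₂ (lookup-RevComp (opposite i)))
                                (cong (opposite ∘ p) (opposite-involutive i))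
  ; b-opposite    = λ i → sym (cong proj₁ (lookup-RevComp i))
  ; barred⇒fixed = barred⇒fixed
  }
  where
  p = ∣_∣ ∘ lookup π
  lookup-RevComp : ∀ i → lookup π i ≡ (barred (lookup π (opposite i)) , opposite (p (opposite i)))
  lookup-RevComp i = begin
    lookup π i                                                   ≡⟨ cong (λ v → lookup v i) π≡RevComp ⟩
    lookup (Rev (Comp π)) i                                      ≡⟨ lookup-reverse (Comp π) i ⟩
    lookup (Comp π) (opposite i)                                 ≡⟨ lookup-map (opposite i) _ π ⟩
    (barred (lookup π (opposite i)) , opposite (p (opposite i))) ∎
    where open ≡-Reasoning
  barred⇒fixed : ∀ i → barred (lookup π i) ≡ true → p i ≡ i
  barred⇒fixed i bi with <-cmp i (p i)
  ... | tri≈ _ i≡pi _ = sym i≡pi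
  ... | tri< i<pi _ _ = contradiction (subst (_<F p i) (sym (involutive i)) i<pi)
                                      (avoids i (p i) i<pi bi (trans (sym (b-cycle i)) bi))
  ... | tri> _ _ pi<i = contradiction (subst (p i <F_) (sym (involutive i)) pi<i)
                                      (avoids (p i) i pi<i (trans (sym (b-cycle i)) bi) bi)

restricted-tabulate : ∀ {p : Fin m → Fin m} {b} → IsRestricted p b →
                      IsRestrictedInvolution (tabulate λ i → b i , p i)
restricted-tabulate {m} {p} {b} R =
  (signed-perm , involution , bar-cycle) , Pointwise-≡⇒≡ (ext π≗RevComp) , avoids
  where
  open IsRestricted R
  open ≡-Reasoning
  π : Vec (SLetter m) m
  π = tabulate λ i → b i , p i
  lookup-π : ∀ i → lookup π i ≡ (b i , p i)
  lookup-π = lookup∘tabulate _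

  signed-perm : IsSignedPerm π
  signed-perm a = begin
    count (λ x → ∣ x ∣ ≟ a) π
      ≡⟨ count≡countᶠ (λ x → ∣ x ∣ ≟ a) π ⟩
    countᶠ (λ i → does (∣ lookup π i ∣ ≟ a))
      ≡⟨ countᶠ-cong (λ i → cong (λ x → does (∣ x ∣ ≟ a)) (lookup-π i)) ⟩
    countᶠ (λ i → does (p i ≟ a))
      ≡⟨ countᶠ-singleton _ (p a) (dec-true (p (p a) ≟ a) (involutive a)) only-p-a ⟩
    1 ∎
    where
    only-p-a : ∀ i → does (p i ≟ a) ≡ true → i ≡ p a
    only-p-a i pi≡a = trans (sym (involutive i)) (cong p (true⇒witness (p i ≟ a) pi≡a))

  involution : ∀ i → ∣ lookup π ∣ lookup π i ∣ ∣ ≡ i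
  involution i rewrite lookup-π i | lookup-π (p i) = involutive i

  bar-cycle : ∀ i → barred (lookup π i) ≡ barred (lookup π ∣ lookup π i ∣)
  bar-cycle i rewrite lookup-π i | lookup-π (p i) = b-cycle i

  π≗RevComp : ∀ i → lookup π i ≡ lookup (Rev (Comp π)) i
  π≗RevComp i = sym (begin
    lookup (Rev (Comp π)) i
      ≡⟨ lookup-reverse (Comp π) i ⟩
    lookup (Comp π) (opposite i)
      ≡⟨ lookup-map (opposite i) _ π ⟩
    (barred (lookup π (opposite i)) , opposite ∣ lookup π (opposite i) ∣)
      ≡⟨ cong (λ x → barred x , opposite ∣ x ∣) (lookup-π (opposite i)) ⟩
    (b (opposite i) , opposite (p (opposite i)))
      ≡⟨ cong₂ _,_ (b-opposite i) (cong opposite (p-opposite i)) ⟩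
    (b i , opposite (opposite (p i)))
      ≡⟨ cong (b i ,_) (opposite-involutive (p i)) ⟩
    (b i , p i)
      ≡⟨ lookup-π i ⟨
    lookup π i
      ∎)

  avoids : Avoids2̄1̄ π
  avoids i j i<j bi bj rewrite lookup-π i | lookup-π j
    rewrite barred⇒fixed i bi | barred⇒fixed j bj = <-asym i<j

-- Encoding

symbolAt : Fin m → Fin m → Bool → Sym
symbolAt i j b = if does (j ≟ i) then sign (firstHalf i xor b) else num (toℕ i ⊓ toℕ j)

clanOf : (Fin m → Fin m) → (Fin m → Bool) → Vec Sym m
clanOf p b = tabulate λ i → symbolAt i (p i) (b i)

clanOf-cong : ∀ {p q : Fin m → Fin m} {b c} → (∀ i → p i ≡ q i) → (∀ i → b i ≡ c i) →
              clanOf p b ≡ clanOf q c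
clanOf-cong p≗q b≗c = tabulate-cong λ i → cong₂ (symbolAt i) (p≗q i) (b≗c i)

module _ {p : Fin m → Fin m} {b : Fin m → Bool} where

  lookup-clanOf-fixed : ∀ {i} → p i ≡ i → lookup (clanOf p b) i ≡ sign (firstHalf i xor b i)
  lookup-clanOf-fixed {i} pi≡i
    rewrite lookup∘tabulate (λ i → symbolAt i (p i) (b i)) i | dec-true (p i ≟ i) pi≡i = refl

  lookup-clanOf-moved : ∀ {i} → p i ≢ i → lookup (clanOf p b) i ≡ num (toℕ i ⊓ toℕ (p i))
  lookup-clanOf-moved {i} pi≢i
    rewrite lookup∘tabulate (λ i → symbolAt i (p i) (b i)) i | dec-false (p i ≟ i) pi≢i = refl

  lookup-clanOf-num⇒moved : ∀ {i k} → lookup (clanOf p b) i ≡ num k → p i ≢ i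
  lookup-clanOf-num⇒moved Γi pi≡i = sign≢num (trans (sym (lookup-clanOf-fixed pi≡i)) Γi)

  module _ (involutive : ∀ i → p (p i) ≡ i) where

    involution-⊓-injective : ∀ {i j} → i ≢ j → toℕ i ⊓ toℕ (p i) ≡ toℕ j ⊓ toℕ (p j) → p i ≡ j
    involution-⊓-injective {i} {j} i≢j eq
      with ℕ.⊓-sel (toℕ i) (toℕ (p i)) | ℕ.⊓-sel (toℕ j) (toℕ (p j))
    ... | inj₁ ⊓≡i  | inj₁ ⊓≡j  = contradiction (toℕ-injective (trans (sym ⊓≡i) (trans eq ⊓≡j))) i≢j
    ... | inj₁ ⊓≡i  | inj₂ ⊓≡pj =
      trans (cong p (toℕ-injective (trans (sym ⊓≡i) (trans eq ⊓≡pj)))) (involutive j)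
    ... | inj₂ ⊓≡pi | inj₁ ⊓≡j  = toℕ-injective (trans (sym ⊓≡pi) (trans eq ⊓≡j))
    ... | inj₂ ⊓≡pi | inj₂ ⊓≡pj = contradiction (trans (sym (involutive i))
      (trans (cong p (toℕ-injective (trans (sym ⊓≡pi) (trans eq ⊓≡pj)))) (involutive j))) i≢j

    clanOf-matched : ∀ {i j} → i ≢ j → p i ≡ j → Matched (clanOf p b) i j
    clanOf-matched {i} {j} i≢j pi≡j =
      toℕ i ⊓ toℕ (p i) , lookup-clanOf-moved pi≢i , trans (lookup-clanOf-moved pj≢j) (cong num same-label)
      where
      pj≡i : p j ≡ i
      pj≡i = trans (cong p (sym pi≡j)) (involutive i)
      pi≢i : p i ≢ i
      pi≢i pi≡i = i≢j (trans (sym pi≡i) pi≡j)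
      pj≢j : p j ≢ j
      pj≢j pj≡j = i≢j (trans (sym pj≡i) pj≡j)
      same-label : toℕ j ⊓ toℕ (p j) ≡ toℕ i ⊓ toℕ (p i)
      same-label rewrite pj≡i | pi≡j = ℕ.⊓-comm (toℕ j) (toℕ i)

    clanOf-matched⁻¹ : ∀ {i j} → i ≢ j → Matched (clanOf p b) i j → p i ≡ j
    clanOf-matched⁻¹ {i} {j} i≢j (k , Γi , Γj) = involution-⊓-injective i≢j (num-injective (begin
      num (toℕ i ⊓ toℕ (p i)) ≡⟨ lookup-clanOf-moved (lookup-clanOf-num⇒moved Γi) ⟨
      lookup (clanOf p b) i   ≡⟨ trans Γi (sym Γj) ⟩
      lookup (clanOf p b) j   ≡⟨ lookup-clanOf-moved (lookup-clanOf-num⇒moved Γj) ⟩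
      num (toℕ j ⊓ toℕ (p j)) ∎))
      where
      open ≡-Reasoning
      num-injective : ∀ {a c} → num a ≡ num c → a ≡ c
      num-injective refl = refl

module _ (no-mid : NoMiddle m) {p : Fin m → Fin m} {b : Fin m → Bool} (R : IsRestricted p b) where
  open IsRestricted R

  clanOf-skew : IsSkewSymmetric (clanOf p b)
  clanOf-skew = skew-intro (clanOf p b) flips-sign keeps-pairs
    where
    flips-sign : ∀ {i} s → lookup (clanOf p b) i ≡ sign s →
                 lookup (clanOf p b) (opposite i) ≡ sign (not s)
    flips-sign {i} s Γi with p i ≟ i
    ... | no pi≢i = contradiction (trans (sym Γi) (lookup-clanOf-moved pi≢i)) sign≢num
    ... | yes pi≡i = begin
      lookup (clanOf p b) (opposite i)
        ≡⟨ lookup-clanOf-fixed (trans (p-opposite i) (cong opposite pi≡i)) ⟩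
      sign (firstHalf (opposite i) xor b (opposite i))
        ≡⟨ cong₂ (λ h c → sign (h xor c)) (firstHalf-opposite no-mid i) (b-opposite i) ⟩
      sign (not (firstHalf i) xor b i)
        ≡⟨ cong sign (not-distribˡ-xor (firstHalf i) (b i)) ⟨
      sign (not (firstHalf i xor b i))
        ≡⟨ cong (sign ∘ not) (sign-injective (trans (sym (lookup-clanOf-fixed pi≡i)) Γi)) ⟩
      sign (not s)
        ∎
      where open ≡-Reasoning
    keeps-pairs : ∀ {i j} → i ≢ j → Matched (clanOf p b) i j →
                  Matched (clanOf p b) (opposite i) (opposite j)
    keeps-pairs {i} {j} i≢j Γij = clanOf-matched involutive (i≢j ∘ opposite-injective)
      (trans (p-opposite i) (cong opposite (clanOf-matched⁻¹ involutive i≢j Γij)))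

  clanOf-isClan : IsClan (clanOf p b)
  clanOf-isClan = labels-twice , skew-balanced {γ = clanOf p b} clanOf-skew
    where
    labels-twice : ∀ k → num k ∈ clanOf p b → count (_≟S num k) (clanOf p b) ≡ 2
    labels-twice k k∈Γ = trans (count≡countᶠ (_≟S num k) Γ)
      (countᶠ-pair _ i≢pi (dec-true (lookup Γ i ≟S num k) Γi) (dec-true (lookup Γ (p i) ≟S num k) Γpi)
                   only-i-pi)
      where
      Γ = clanOf p b
      i = Any.index k∈Γ
      Γi : lookup Γ i ≡ num k
      Γi = sym (lookup-index k∈Γ)
      i≢pi : i ≢ p i
      i≢pi = lookup-clanOf-num⇒moved Γi ∘ sym
      Γpi : lookup Γ (p i) ≡ num k
      Γpi with clanOf-matched involutive i≢pi refl
      ... | _ , Γi′ , Γpi′ = trans Γpi′ (trans (sym Γi′) Γi)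
      only-i-pi : ∀ j → does (lookup Γ j ≟S num k) ≡ true → j ≡ i ⊎ j ≡ p i
      only-i-pi j Γj with j ≟ i
      ... | yes j≡i = inj₁ j≡i
      ... | no  j≢i = inj₂ (sym (clanOf-matched⁻¹ involutive (j≢i ∘ sym)
                                  (k , Γi , true⇒witness (lookup Γ j ≟S num k) Γj)))

-- Decoding

-- Position i of γ is read as the letter π(i) = j, barred iff b.
data Decoded (γ : Vec Sym m) (i : Fin m) : Fin m → Bool → Set where
  signed : ∀ {b} → lookup γ i ≡ sign (firstHalf i xor b) → Decoded γ i i b
  paired : ∀ {j} → j ≢ i → Matched γ i j → Decoded γ i j false

module _ {γ : Vec Sym m} where

  Decoded-symmetric : ∀ {i j b} → Decoded γ i j b → Decoded γ j i b
  Decoded-symmetric (signed γi)                = signed γi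
  Decoded-symmetric (paired j≢i (k , γi , γj)) = paired (j≢i ∘ sym) (k , γj , γi)

  Decoded-barred : ∀ {i j} → Decoded γ i j true → j ≡ i
  Decoded-barred (signed _) = refl

  Decoded-transport : ∀ {δ i j b} → γ ≈Clan δ → Decoded γ i j b → Decoded δ i j b
  Decoded-transport {δ} γ≈δ (signed γi) = signed (≈Clan-sign {γ = γ} {δ} γ≈δ _ γi)
  Decoded-transport {i = i} {j} γ≈δ (paired j≢i γij) =
    paired j≢i (to (proj₂ (proj₂ γ≈δ) i j (j≢i ∘ sym)) γij)

  Decoded-opposite : NoMiddle m → IsSkewSymmetric γ →
                     ∀ {i j b} → Decoded γ i j b → Decoded γ (opposite i) (opposite j) b
  Decoded-opposite no-mid skew {i} {b = b} (signed γi) = signed (begin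
    lookup γ (opposite i)               ≡⟨ skew-sign {γ = γ} skew _ γi ⟩
    sign (not (firstHalf i xor b))      ≡⟨ cong sign (not-distribˡ-xor (firstHalf i) b) ⟩
    sign (not (firstHalf i) xor b)      ≡⟨ cong (λ h → sign (h xor b)) (firstHalf-opposite no-mid i) ⟨
    sign (firstHalf (opposite i) xor b) ∎)
    where open ≡-Reasoning
  Decoded-opposite no-mid skew (paired j≢i γij) =
    paired (j≢i ∘ opposite-injective) (skew-matched {γ = γ} skew (j≢i ∘ sym) γij)

  module _ (clan : IsClan γ) where

    Decoded-total : ∀ i → ∃₂ λ j b → Decoded γ i j b
    Decoded-total i with lookup γ i in γi
    ... | plus  = i , not (firstHalf i) , signed (trans γi (cong sign (sym (xor-inverseʳ (firstHalf i)))))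
    ... | minus = i , firstHalf i , signed (trans γi (cong sign (sym (xor-same (firstHalf i)))))
    ... | num k with clan-partner clan γi
    ...   | j , j≢i , γij = j , false , paired j≢i γij

    Decoded-functional : ∀ {i j j′ b b′} → Decoded γ i j b → Decoded γ i j′ b′ → j ≡ j′ × b ≡ b′
    Decoded-functional {i} (signed γi) (signed γi′) =
      refl , xor-cancelˡ (firstHalf i) (sign-injective (trans (sym γi) γi′))
    Decoded-functional (signed γi) (paired _ (_ , γi′ , _)) = contradiction (trans (sym γi) γi′) sign≢num
    Decoded-functional (paired _ (_ , γi , _)) (signed γi′) = contradiction (trans (sym γi′) γi) sign≢num
    Decoded-functional (paired j≢i γij) (paired j′≢i γij′) =
      clan-partner-unique clan j≢i j′≢i γij γij′ , refl

    Decoded-matched : ∀ {i j l b} → Decoded γ i j b → i ≢ l → Matched γ i l ⇔ j ≡ l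
    Decoded-matched (signed γi) i≢l =
      mk⇔ (λ (_ , γi′ , _) → contradiction (trans (sym γi) γi′) sign≢num) (λ i≡l → contradiction i≡l i≢l)
    Decoded-matched (paired j≢i γij) i≢l =
      mk⇔ (clan-partner-unique clan j≢i (i≢l ∘ sym) γij) (λ j≡l → subst (Matched γ _) j≡l γij)

Decoded-same-sign : ∀ {γ δ : Vec Sym m} {i j b} → Decoded γ i j b → Decoded δ i j b →
                    ∀ s → lookup γ i ≡ sign s ⇔ lookup δ i ≡ sign s
Decoded-same-sign (signed γi) (signed δi) s = mk⇔ (trans (trans δi (sym γi))) (trans (trans γi (sym δi)))
Decoded-same-sign (signed _) (paired i≢i _) s = contradiction refl i≢i
Decoded-same-sign (paired i≢i _) (signed _) s = contradiction refl i≢i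
Decoded-same-sign (paired _ (_ , γi , _)) (paired _ (_ , δi , _)) s = mk⇔
  (λ γi′ → contradiction (trans (sym γi′) γi) sign≢num)
  (λ δi′ → contradiction (trans (sym δi′) δi) sign≢num)

≈Clan-from-decoding : ∀ {γ δ : Vec Sym m} {p : Fin m → Fin m} {b : Fin m → Bool} →
                      IsClan γ → IsClan δ →
                      (∀ i → Decoded γ i (p i) (b i)) → (∀ i → Decoded δ i (p i) (b i)) → γ ≈Clan δ
≈Clan-from-decoding {γ = γ} {δ} γ-clan δ-clan γ-decodes δ-decodes =
    (λ i → Decoded-same-sign {γ = γ} {δ} (γ-decodes i) (δ-decodes i) true)
  , (λ i → Decoded-same-sign {γ = γ} {δ} (γ-decodes i) (δ-decodes i) false)
  , (λ i j i≢j → ⇔-sym (Decoded-matched δ-clan (δ-decodes i) i≢j)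
                   ⇔-∘ Decoded-matched γ-clan (γ-decodes i) i≢j)

clanOf-decodes : ∀ {p : Fin m → Fin m} {b} → IsRestricted p b → ∀ i → Decoded (clanOf p b) i (p i) (b i)
clanOf-decodes {p = p} {b} R i with p i ≟ i
... | yes pi≡i = subst (λ j → Decoded (clanOf p b) i j (b i)) (sym pi≡i) (signed (lookup-clanOf-fixed pi≡i))
... | no  pi≢i = subst (Decoded (clanOf p b) i (p i)) (sym (IsRestricted.moved⇒unbarred R pi≢i))
                       (paired pi≢i (clanOf-matched (IsRestricted.involutive R) (pi≢i ∘ sym) refl))

module _ (no-mid : NoMiddle m) where

  clanOf-injective : ∀ {p p′ : Fin m → Fin m} {b b′} → IsRestricted p b → IsRestricted p′ b′ →
                     clanOf p b ≈Clan clanOf p′ b′ → ∀ i → p i ≡ p′ i × b i ≡ b′ i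
  clanOf-injective R R′ Γ≈Γ′ i = Decoded-functional (clanOf-isClan no-mid R′)
    (Decoded-transport Γ≈Γ′ (clanOf-decodes R i)) (clanOf-decodes R′ i)

  skew-clan-decodes : ∀ {γ : Vec Sym m} → IsClan γ → IsSkewSymmetric γ →
                      ∃₂ λ p b → IsRestricted p b × clanOf p b ≈Clan γ
  skew-clan-decodes {γ} clan skew =
    partner , bar , R , ≈Clan-from-decoding {p = partner} {bar} (clanOf-isClan no-mid R) clan
                                            (clanOf-decodes R) decoded
    where
    partner : Fin m → Fin m
    partner i = proj₁ (Decoded-total clan i)
    bar : Fin m → Bool
    bar i = proj₁ (proj₂ (Decoded-total clan i))
    decoded : ∀ i → Decoded γ i (partner i) (bar i)
    decoded i = proj₂ (proj₂ (Decoded-total clan i))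
    decoded-opposite : ∀ i → Decoded γ (opposite i) (opposite (partner i)) (bar i)
    decoded-opposite i = Decoded-opposite no-mid skew (decoded i)
    R : IsRestricted partner bar
    R = record
      { involutive    = λ i → proj₁ (Decoded-functional clan (decoded (partner i)) (Decoded-symmetric (decoded i)))
      ; p-opposite    = λ i → proj₁ (Decoded-functional clan (decoded (opposite i)) (decoded-opposite i))
      ; b-opposite    = λ i → proj₂ (Decoded-functional clan (decoded (opposite i)) (decoded-opposite i))
      ; barred⇒fixed = λ i bi → Decoded-barred (subst (Decoded γ i (partner i)) bi (decoded i))
      }

theorem3p14 : ∀ (n : ℕ) → 1 ≤ n →
    ∃ λ (f : RestrictedInvolution n → SkewClan n) → Bijective n f
theorem3p14 n _ = toClan , (λ { a _ refl → ≈Clan-refl (proj₁ (toClan a)) }) , injective , surjective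
  where
  no-mid = no-middle n

  toClan : RestrictedInvolution n → SkewClan n
  toClan (π , R) = clanOf (∣_∣ ∘ lookup π) (barred ∘ lookup π) , clanOf-isClan no-mid R′ , clanOf-skew no-mid R′
    where R′ = restricted-lookup R

  injective : ∀ a b → proj₁ (toClan a) ≈Clan proj₁ (toClan b) → proj₁ a ≡ proj₁ b
  injective (π , R) (π′ , R′) Γ≈Γ′ = Pointwise-≡⇒≡ (ext λ i →
    let p≡p′ , b≡b′ = clanOf-injective no-mid (restricted-lookup R) (restricted-lookup R′) Γ≈Γ′ i
    in cong₂ _,_ b≡b′ p≡p′)

  surjective : ∀ c → ∃ λ a → proj₁ (toClan a) ≈Clan proj₁ c
  surjective (γ , clan , skew) =
    let p , b , R , Γ≈γ = skew-clan-decodes no-mid clan skew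
        lookup-π = lookup∘tabulate (λ i → b i , p i)
    in (tabulate (λ i → b i , p i) , restricted-tabulate R)
     , subst (_≈Clan γ) (sym (clanOf-cong (cong proj₂ ∘ lookup-π) (cong proj₁ ∘ lookup-π))) Γ≈γ
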